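{- Let $A$ be a commutative algebra over a field containing $\mathbb{Q}(q)$ and $F\in A[[t]]$ with $F(0)=0$. For $k\ge0$ write $F^{[k]^*}(t)=\sum_{n\ge0}f_{n,k}\,t^n/[n]_q!$. Then for all $k\ge1$ and $n\ge0$, \[ f_{n+1,k}=[k]_q\,q^{ -(k-1)}\sum_{j=0}^{n}\binom{n}{j}_q f_{n-j+1,1}\,f_{j,k-1}\,q^{j}, \] and $f_{n,k}=0$ for $n<k$.
   Context: $[n]_q=1+q+\cdots+q^{n-1}$ ($n\ge1$), $[0]_q=0$, $[n]_q!=[1]_q\cdots[n]_q$, $[0]_q!=1$, $\binom nj_q=\frac{[n]_q!}{[j]_q![n-j]_q!}$. $D_qF(t)=\frac{F(qt)-F(t)}{(q-1)t}$. The $q^*$-powers: $F^{[0]^*}=1$ and for $k\ge1$, $F^{[k]^*}$ is the series with zero constant term satisfying $D_qF^{[k]^*}(t)=[k]_q\,q^{ -(k-1)}F^{[k-1]^*}(qt)\,D_qF(t)$. -}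

module Defs where

open import Level using (Level; _⊔_)
open import Data.Nat using (ℕ; zero; suc; _∸_)
open import Data.Integer using (ℤ; +_; -[1+_])
open import Data.List using (List; []; _∷_)
open import Data.List.Relation.Unary.Any using (Any)
open import Data.Product using (Σ; _×_)
open import Relation.Nullary using (¬_)
open import Relation.Binary.PropositionalEquality using (_≡_)
open import Algebra.Bundles using (CommutativeRing)

module _ {c ℓ} (R : CommutativeRing c ℓ) where
  open CommutativeRing R

  pow : Carrier → ℕ → Carrier
  pow x zero    = 1#
  pow x (suc n) = pow x n * x

  natR : ℕ → Carrier
  natR zero    = 0#
  natR (suc n) = natR n + 1#

  intR : ℤ → Carrier
  intR (+ n)      = natR n
  intR -[1+ n ]   = - natR (suc n)

  evalPoly : List ℤ → Carrier → Carrier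
  evalPoly []       x = 0#
  evalPoly (a ∷ as) x = intR a + x * evalPoly as x

  record IsField : Set (c ⊔ ℓ) where
    field
      nontrivial : ¬ (1# ≈ 0#)
      inverse    : ∀ x → ¬ (x ≈ 0#) → Σ Carrier (λ y → x * y ≈ 1#)

  -- q is transcendental over ℚ (with IsField this says the field contains ℚ(q)):
  -- no nonzero integer polynomial vanishes at q
  Transcendental : Carrier → Set ℓ
  Transcendental q = ∀ (p : List ℤ) → Any (λ a → ¬ (a ≡ + 0)) p → ¬ (evalPoly p q ≈ 0#)

  sumTo : ℕ → (ℕ → Carrier) → Carrier
  sumTo zero    g = 0#
  sumTo (suc n) g = sumTo n g + g n

  module QCalc (q : Carrier) where

    qint : ℕ → Carrier
    qint n = sumTo n (pow q)

    qfact : ℕ → Carrier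
    qfact zero    = 1#
    qfact (suc n) = qfact n * qint (suc n)

    qbinom : ℕ → ℕ → Carrier
    qbinom zero    zero    = 1#
    qbinom zero    (suc j) = 0#
    qbinom (suc n) zero    = 1#
    qbinom (suc n) (suc j) = qbinom n j + pow q (suc j) * qbinom n (suc j)

    Series : Set c
    Series = ℕ → Carrier

    oneS : Series
    oneS zero    = 1#
    oneS (suc n) = 0#

    _⋆_ : Series → Series → Series
    (a ⋆ b) n = sumTo (suc n) (λ i → a i * b (n ∸ i))

    dil : Series → Series
    dil a n = pow q n * a n

    -- q-derivative D_q G(t) = (G(qt) - G(t)) / ((q-1) t), computed coefficientwise:
    -- the coefficient of t^n is [n+1]_q · g_{n+1}
    Dq : Series → Series
    Dq a n = qint (suc n) * a (suc n)

    -- P k = F^{[k]*}, where qi is the inverse of q: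
    -- F^{[0]*} = 1; for k ≥ 1, F^{[k]*} has zero constant term and
    -- D_q F^{[k]*}(t) = [k]_q q^{-(k-1)} F^{[k-1]*}(qt) D_q F(t)
    record IsQStarPowers (qi : Carrier) (F : Series) (P : ℕ → Series) : Set (c ⊔ ℓ) where
      field
        power0   : ∀ n → P 0 n ≈ oneS n
        constant : ∀ k → P (suc k) 0 ≈ 0#
        deriv    : ∀ k n → Dq (P (suc k)) n
                     ≈ qint (suc k) * pow qi k * (dil (P k) ⋆ Dq F) n

    fcoef : (ℕ → Series) → ℕ → ℕ → Carrier
    fcoef P n k = qfact n * P k n

-- Multiplying the defining q-differential equation of F^{[k+1]*} by [n]_q! turns it
-- into a relation between the coefficients f: the q-Cauchy product of F^{[k]*}(qt) and
-- D_q F becomes a q-binomial convolution, because [n]_q! = (n choose j)_q [j]_q! [n-j]_q!,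
-- and D_q F = D_q F^{[1]*} identifies its coefficients with f_{m+1,1} / [m]_q!.
-- Vanishing below the diagonal follows from the recurrence by induction on k, starting
-- from the zero constant terms.
module Submission where

open import Defs
open import Data.Nat using (ℕ; zero; suc; _∸_; _≤_; _<_; s≤s)
import Data.Nat as ℕ
import Data.Nat.Properties as ℕ
open import Data.Product using (_×_; _,_)
open import Algebra.Bundles using (CommutativeRing)
open import Algebra.Morphism.Structures using (IsRingHomomorphism)
import Algebra.Solver.CommutativeMonoid as CommutativeMonoidSolver
import Relation.Binary.PropositionalEquality as ≡

module _ {c ℓ} (R : CommutativeRing c ℓ) where
  open CommutativeRing R
  open import Relation.Binary.Reasoning.Setoid setoid
  open CommutativeMonoidSolver *-commutativeMonoid using (solve; _⊕_; _⊜_)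

  sumTo-cong : ∀ m {g h : ℕ → Carrier} → (∀ j → j < m → g j ≈ h j) →
               sumTo R m g ≈ sumTo R m h
  sumTo-cong zero    g≈h = refl
  sumTo-cong (suc m) g≈h =
    +-cong (sumTo-cong m (λ j j<m → g≈h j (ℕ.m≤n⇒m≤1+n j<m))) (g≈h m ℕ.≤-refl)

  sumTo-zero : ∀ m {g : ℕ → Carrier} → (∀ j → j < m → g j ≈ 0#) → sumTo R m g ≈ 0#
  sumTo-zero zero    g≈0 = refl
  sumTo-zero (suc m) g≈0 = begin
    sumTo R m _ + _ ≈⟨ +-cong (sumTo-zero m (λ j j<m → g≈0 j (ℕ.m≤n⇒m≤1+n j<m)))
                              (g≈0 m ℕ.≤-refl) ⟩
    0# + 0#         ≈⟨ +-identityˡ 0# ⟩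
    0#              ∎

  *-distribˡ-sumTo : ∀ m x (g : ℕ → Carrier) →
                     x * sumTo R m g ≈ sumTo R m (λ j → x * g j)
  *-distribˡ-sumTo zero    x g = zeroʳ x
  *-distribˡ-sumTo (suc m) x g =
    trans (distribˡ x _ _) (+-cong (*-distribˡ-sumTo m x g) refl)

  sumTo-sucˡ : ∀ m (g : ℕ → Carrier) →
               sumTo R (suc m) g ≈ g 0 + sumTo R m (λ i → g (suc i))
  sumTo-sucˡ zero    g = trans (+-identityˡ _) (sym (+-identityʳ _))
  sumTo-sucˡ (suc m) g = begin
    sumTo R (suc m) g + g (suc m)                   ≈⟨ +-cong (sumTo-sucˡ m g) refl ⟩
    (g 0 + sumTo R m (λ i → g (suc i))) + g (suc m) ≈⟨ +-assoc _ _ _ ⟩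
    g 0 + sumTo R (suc m) (λ i → g (suc i))         ∎

  pow-+ : ∀ x a b → pow R x (a ℕ.+ b) ≈ pow R x a * pow R x b
  pow-+ x zero    b = sym (*-identityˡ _)
  pow-+ x (suc a) b = begin
    pow R x (a ℕ.+ b) * x     ≈⟨ *-cong (pow-+ x a b) refl ⟩
    pow R x a * pow R x b * x ≈⟨ solve 3 (λ u v w → (u ⊕ v) ⊕ w ⊜ (u ⊕ w) ⊕ v) refl _ _ _ ⟩
    pow R x a * x * pow R x b ∎

  module _ (q : Carrier) where
    open QCalc R q

    qint-+ : ∀ a b → qint (a ℕ.+ b) ≈ qint a + pow R q a * qint b
    qint-+ a zero    rewrite ℕ.+-identityʳ a = begin
      qint a                  ≈⟨ sym (+-identityʳ _) ⟩
      qint a + 0#             ≈⟨ +-cong refl (sym (zeroʳ _)) ⟩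
      qint a + pow R q a * 0# ∎
    qint-+ a (suc b) rewrite ℕ.+-suc a b = begin
      qint (a ℕ.+ b) + pow R q (a ℕ.+ b)
        ≈⟨ +-cong (qint-+ a b) (pow-+ q a b) ⟩
      (qint a + pow R q a * qint b) + pow R q a * pow R q b
        ≈⟨ +-assoc _ _ _ ⟩
      qint a + (pow R q a * qint b + pow R q a * pow R q b)
        ≈⟨ +-cong refl (sym (distribˡ _ _ _)) ⟩
      qint a + pow R q a * qint (suc b) ∎

    qbinom-n0≈1 : ∀ n → qbinom n 0 ≈ 1#
    qbinom-n0≈1 zero    = refl
    qbinom-n0≈1 (suc n) = refl

    k>n⇒qbinom≈0 : ∀ n k → n < k → qbinom n k ≈ 0#
    k>n⇒qbinom≈0 zero    (suc k) _         = refl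
    k>n⇒qbinom≈0 (suc n) (suc k) (s≤s n<k) = begin
      qbinom n k + pow R q (suc k) * qbinom n (suc k)
        ≈⟨ +-cong (k>n⇒qbinom≈0 n k n<k)
                  (*-cong refl (k>n⇒qbinom≈0 n (suc k) (ℕ.m≤n⇒m≤1+n n<k))) ⟩
      0# + pow R q (suc k) * 0# ≈⟨ trans (+-identityˡ _) (zeroʳ _) ⟩
      0#                        ∎

    qbinom-nn≈1 : ∀ n → qbinom n n ≈ 1#
    qbinom-nn≈1 zero    = refl
    qbinom-nn≈1 (suc n) = begin
      qbinom n n + pow R q (suc n) * qbinom n (suc n)
        ≈⟨ +-cong (qbinom-nn≈1 n) (*-cong refl (k>n⇒qbinom≈0 n (suc n) ℕ.≤-refl)) ⟩
      1# + pow R q (suc n) * 0# ≈⟨ trans (+-cong refl (zeroʳ _)) (+-identityʳ 1#) ⟩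
      1#                        ∎

    -- The q-Pascal rule splits [a+b+2]_q as [a+1]_q + q^{a+1} [b+1]_q.
    qbinom*qfact*qfact≈qfact : ∀ a b →
      qbinom (a ℕ.+ b) a * qfact a * qfact b ≈ qfact (a ℕ.+ b)
    qbinom*qfact*qfact≈qfact zero b = begin
      qbinom b 0 * 1# * qfact b ≈⟨ *-cong (trans (*-identityʳ _) (qbinom-n0≈1 b)) refl ⟩
      1# * qfact b              ≈⟨ *-identityˡ _ ⟩
      qfact b                   ∎
    qbinom*qfact*qfact≈qfact (suc a) zero rewrite ℕ.+-identityʳ a = begin
      qbinom (suc a) (suc a) * qfact (suc a) * 1# ≈⟨ *-identityʳ _ ⟩
      qbinom (suc a) (suc a) * qfact (suc a)      ≈⟨ *-cong (qbinom-nn≈1 (suc a)) refl ⟩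
      1# * qfact (suc a)                          ≈⟨ *-identityˡ _ ⟩
      qfact (suc a)                               ∎
    qbinom*qfact*qfact≈qfact (suc a) (suc b) = begin
      (X + c′ * Y) * (qfact a * u) * (qfact b * v)
        ≈⟨ trans (*-cong (distribʳ _ _ _) refl) (distribʳ _ _ _) ⟩
      X * (qfact a * u) * (qfact b * v) + c′ * Y * (qfact a * u) * (qfact b * v)
        ≈⟨ +-cong (solve 5 (λ x fa u′ fb v′ → (x ⊕ (fa ⊕ u′)) ⊕ (fb ⊕ v′)
                                            ⊜ u′ ⊕ ((x ⊕ fa) ⊕ (fb ⊕ v′)))
                           refl X (qfact a) u (qfact b) v)
                  (solve 6 (λ c″ y fa u′ fb v′ → ((c″ ⊕ y) ⊕ (fa ⊕ u′)) ⊕ (fb ⊕ v′)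
                                               ⊜ (c″ ⊕ v′) ⊕ ((y ⊕ (fa ⊕ u′)) ⊕ fb))
                           refl c′ Y (qfact a) u (qfact b) v) ⟩
      u * (X * qfact a * qfact (suc b)) + c′ * v * (Y * qfact (suc a) * qfact b)
        ≈⟨ +-cong (*-cong refl (qbinom*qfact*qfact≈qfact a (suc b)))
                  (*-cong refl shifted) ⟩
      u * qfact N + c′ * v * qfact N ≈⟨ sym (distribʳ _ _ _) ⟩
      (u + c′ * v) * qfact N         ≈⟨ *-cong (sym (qint-+ (suc a) (suc b))) refl ⟩
      qint (suc N) * qfact N         ≈⟨ *-comm _ _ ⟩
      qfact N * qint (suc N)         ∎
      where
      N  = a ℕ.+ suc b
      X  = qbinom N a
      Y  = qbinom N (suc a)
      c′ = pow R q (suc a)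
      u  = qint (suc a)
      v  = qint (suc b)
      shifted : Y * qfact (suc a) * qfact b ≈ qfact N
      shifted = ≡.subst (λ M → qbinom M (suc a) * qfact (suc a) * qfact b ≈ qfact M)
                        (≡.sym (ℕ.+-suc a b)) (qbinom*qfact*qfact≈qfact (suc a) b)

    k≤n⇒qbinom*qfact*qfact≈qfact : ∀ {n k} → k ≤ n →
      qbinom n k * qfact k * qfact (n ∸ k) ≈ qfact n
    k≤n⇒qbinom*qfact*qfact≈qfact {n} {k} k≤n =
      ≡.subst (λ M → qbinom M k * qfact k * qfact (n ∸ k) ≈ qfact M)
              (ℕ.m+[n∸m]≡n k≤n) (qbinom*qfact*qfact≈qfact k (n ∸ k))

    dil-oneS-⋆ : ∀ {a : Series} → (∀ n → a n ≈ oneS n) → ∀ (g : Series) m →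
                 (dil a ⋆ g) m ≈ g m
    dil-oneS-⋆ {a} a≈1 g m = begin
      sumTo R (suc m) (λ i → dil a i * g (m ∸ i))
        ≈⟨ sumTo-sucˡ m _ ⟩
      1# * a 0 * g m + sumTo R m (λ i → dil a (suc i) * g (m ∸ suc i))
        ≈⟨ +-cong (*-cong (trans (*-identityˡ _) (a≈1 0)) refl)
                  (sumTo-zero m (λ i _ → begin
                    pow R q (suc i) * a (suc i) * g (m ∸ suc i)
                      ≈⟨ *-cong (*-cong refl (a≈1 (suc i))) refl ⟩
                    pow R q (suc i) * 0# * g (m ∸ suc i)
                      ≈⟨ trans (*-cong (zeroʳ _) refl) (zeroˡ _) ⟩
                    0# ∎)) ⟩
      1# * g m + 0# ≈⟨ trans (+-identityʳ _) (*-identityˡ _) ⟩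
      g m           ∎

module QStarPowers {c ℓ} (A : CommutativeRing c ℓ) (q qi : CommutativeRing.Carrier A)
  (F : ℕ → CommutativeRing.Carrier A) (P : ℕ → ℕ → CommutativeRing.Carrier A)
  (isQStarPowers : QCalc.IsQStarPowers A q qi F P) where
  open CommutativeRing A
  open QCalc A q
  open IsQStarPowers isQStarPowers
  open import Relation.Binary.Reasoning.Setoid setoid
  open CommutativeMonoidSolver *-commutativeMonoid using (solve; _⊕_; _⊜_)

  f : ℕ → ℕ → Carrier
  f = fcoef P

  fcoef-suc : ∀ n k →
    f (suc n) (suc k) ≈ qint (suc k) * pow A qi k * (qfact n * (dil (P k) ⋆ Dq F) n)
  fcoef-suc n k = begin
    qfact n * qint (suc n) * P (suc k) (suc n) ≈⟨ *-assoc _ _ _ ⟩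
    qfact n * Dq (P (suc k)) n                 ≈⟨ *-cong refl (deriv k n) ⟩
    qfact n * (C * S)                          ≈⟨ solve 3 (λ a b s → a ⊕ (b ⊕ s) ⊜ b ⊕ (a ⊕ s))
                                                          refl (qfact n) C S ⟩
    C * (qfact n * S)                          ∎
    where
    C = qint (suc k) * pow A qi k
    S = (dil (P k) ⋆ Dq F) n

  fcoef-first : ∀ n → f (suc n) 1 ≈ qfact n * Dq F n
  fcoef-first n = begin
    f (suc n) 1                                       ≈⟨ fcoef-suc n 0 ⟩
    (0# + 1#) * 1# * (qfact n * (dil (P 0) ⋆ Dq F) n)
      ≈⟨ *-cong (trans (*-identityʳ _) (+-identityˡ 1#))
                (*-cong refl (dil-oneS-⋆ A q power0 (Dq F) n)) ⟩
    1# * (qfact n * Dq F n)                           ≈⟨ *-identityˡ _ ⟩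
    qfact n * Dq F n                                  ∎

  convolution-term : ∀ {n} k j → j ≤ n →
    qfact n * (dil (P k) j * Dq F (n ∸ j))
      ≈ qbinom n j * f (suc (n ∸ j)) 1 * f j k * pow A q j
  convolution-term {n} k j j≤n = begin
    qfact n * (pow A q j * P k j * Dq F m)
      ≈⟨ *-cong (sym (k≤n⇒qbinom*qfact*qfact≈qfact A q j≤n)) refl ⟩
    qbinom n j * qfact j * qfact m * (pow A q j * P k j * Dq F m)
      ≈⟨ solve 6 (λ b fj fm qj p d → ((b ⊕ fj) ⊕ fm) ⊕ ((qj ⊕ p) ⊕ d)
                                   ⊜ ((b ⊕ (fm ⊕ d)) ⊕ (fj ⊕ p)) ⊕ qj)
               refl (qbinom n j) (qfact j) (qfact m) (pow A q j) (P k j) (Dq F m) ⟩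
    qbinom n j * (qfact m * Dq F m) * f j k * pow A q j
      ≈⟨ *-cong (*-cong (*-cong refl (sym (fcoef-first m))) refl) refl ⟩
    qbinom n j * f (suc m) 1 * f j k * pow A q j ∎
    where m = n ∸ j

  fcoef-recurrence : ∀ k n →
    f (suc n) (suc k) ≈ qint (suc k) * pow A qi k
      * sumTo A (suc n) (λ j → qbinom n j * f (suc (n ∸ j)) 1 * f j k * pow A q j)
  fcoef-recurrence k n = begin
    f (suc n) (suc k)                    ≈⟨ fcoef-suc n k ⟩
    C * (qfact n * (dil (P k) ⋆ Dq F) n) ≈⟨ *-cong refl (*-distribˡ-sumTo A (suc n) (qfact n) _) ⟩
    C * sumTo A (suc n) (λ j → qfact n * (dil (P k) j * Dq F (n ∸ j)))
      ≈⟨ *-cong refl (sumTo-cong A (suc n) (λ j j<1+n → convolution-term k j (ℕ.≤-pred j<1+n))) ⟩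
    C * sumTo A (suc n) (λ j → qbinom n j * f (suc (n ∸ j)) 1 * f j k * pow A q j) ∎
    where C = qint (suc k) * pow A qi k

  fcoef-below : ∀ k n → n < k → f n k ≈ 0#
  fcoef-below (suc k) zero    _         = trans (*-identityˡ _) (constant k)
  fcoef-below (suc k) (suc n) (s≤s n<k) = begin
    f (suc n) (suc k)                      ≈⟨ fcoef-recurrence k n ⟩
    C * sumTo A (suc n) _                  ≈⟨ *-cong refl (sumTo-zero A (suc n) vanishing) ⟩
    C * 0#                                 ≈⟨ zeroʳ C ⟩
    0#                                     ∎
    where
    C = qint (suc k) * pow A qi k
    vanishing : ∀ j → j < suc n →
                qbinom n j * f (suc (n ∸ j)) 1 * f j k * pow A q j ≈ 0#
    vanishing j j<1+n = begin
      qbinom n j * f (suc (n ∸ j)) 1 * f j k * pow A q j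
        ≈⟨ *-cong (*-cong refl (fcoef-below k j (ℕ.<-≤-trans j<1+n n<k))) refl ⟩
      qbinom n j * f (suc (n ∸ j)) 1 * 0# * pow A q j
        ≈⟨ trans (*-cong (zeroʳ _) refl) (zeroˡ _) ⟩
      0# ∎

-- Nothing about K, φ or F 0 is needed: the q*-powers are given by their coefficients,
-- so the recurrence holds over any commutative ring, for any q and any qi.
proposition6p2 : ∀ {c ℓ c′ ℓ′} (K : CommutativeRing c ℓ) → IsField K
    → (q qi : CommutativeRing.Carrier K) → Transcendental K q
    → CommutativeRing._≈_ K (CommutativeRing._*_ K q qi) (CommutativeRing.1# K)
    → (A : CommutativeRing c′ ℓ′) (φ : CommutativeRing.Carrier K → CommutativeRing.Carrier A)
    → IsRingHomomorphism (CommutativeRing.rawRing K) (CommutativeRing.rawRing A) φ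
    → (F : ℕ → CommutativeRing.Carrier A) → CommutativeRing._≈_ A (F 0) (CommutativeRing.0# A)
    → (P : ℕ → ℕ → CommutativeRing.Carrier A) → QCalc.IsQStarPowers A (φ q) (φ qi) F P
    → let open CommutativeRing A
          open QCalc A (φ q)
          f = fcoef P
      in (∀ k n → 1 ≤ k →
            f (suc n) k ≈ qint k * pow A (φ qi) (k ∸ 1)
              * sumTo A (suc n) (λ j → qbinom n j * f (suc (n ∸ j)) 1 * f j (k ∸ 1) * pow A (φ q) j))
         × (∀ k n → n < k → f n k ≈ 0#)
proposition6p2 K _ q qi _ _ A φ _ F _ P isQStarPowers =
  (λ { (suc k) n _ → fcoef-recurrence k n }) , fcoef-below
  where open QStarPowers A (φ q) (φ qi) F P isQStarPowers
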